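{- Let $D$ and $D_1$ be block designs built on the same finite set $V$ which are friends, let $k_D$ be the block size of $D$, and let $\varphi(D,D_1)=(z_0,z_1,\dots,z_{k_D})$. Let $D_2$ be the complement design of $D_1$, i.e. the design whose blocks are $D_2^s=V\setminus D_1^s$ for all blocks $D_1^s$ of $D_1$. Then $D$ and $D_2$ are friends, and $\varphi(D,D_2)=(\omega_0,\dots,\omega_{k_D})$ satisfies $\omega_i=z_{k_D-i}$ for $i=0,\dots,k_D$.
   Context: A block design with parameters $(v,b,r,k,\lambda)$ built on a finite set $V$ ($|V|=v$) is a list of $b$ blocks, each a $k$-subset of $V$, such that every element lies in exactly $r$ blocks and every pair of distinct elements lies in exactly $\lambda$ blocks; designs are simple. For a design $D$ with blocks $B_1,\dots,B_b$ of size $k$ and $M\subseteq V$, $\varphi(D,M)=(z_0,\dots,z_k)$ where $z_j$ is the number of $s$ with $|M\cap B_s|=j$. Designs $D_1,D_2$ on $V$ are friends if $\varphi(D_1,D_2^i)$ is independent of the block $D_2^i$ of $D_2$ and $\varphi(D_2,D_1^j)$ is independent of the block $D_1^j$ of $D_1$; the common values are written $\varphi(D_1,D_2)$, $\varphi(D_2,D_1)$. -}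

module Defs where

open import Data.Nat using (ℕ; suc; _≟_)
open import Data.Fin using (Fin; toℕ)
open import Data.Fin.Subset using (Subset; _∩_; ∣_∣; ∁)
open import Data.Fin.Subset.Properties using (_∈?_)
open import Data.Vec using (Vec; tabulate; count; allFin)
open import Data.Product using (_×_)
open import Relation.Nullary.Decidable using (_×-dec_)
open import Relation.Binary.PropositionalEquality using (_≡_; _≢_)
open import Function.Definitions using (Injective)

record IsDesign (v b r k lam : ℕ) (B : Fin b → Subset v) : Set where
  field
    blockSize : ∀ s → ∣ B s ∣ ≡ k
    replication : ∀ (x : Fin v) → count (λ s → x ∈? B s) (allFin b) ≡ r
    balance : ∀ (x y : Fin v) → x ≢ y →
      count (λ s → (x ∈? B s) ×-dec (y ∈? B s)) (allFin b) ≡ lam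
    simple : Injective _≡_ _≡_ B

φ : ∀ {v b} (k : ℕ) → (Fin b → Subset v) → Subset v → Vec ℕ (suc k)
φ {v} {b} k B M = tabulate (λ j → count (λ s → ∣ M ∩ B s ∣ ≟ toℕ j) (allFin b))

Friends : ∀ {v b₁ b₂} (k₁ : ℕ) → (Fin b₁ → Subset v) → (k₂ : ℕ) → (Fin b₂ → Subset v) → Set
Friends {v} {b₁} {b₂} k₁ B₁ k₂ B₂ =
  (∀ (i i′ : Fin b₂) → φ k₁ B₁ (B₂ i) ≡ φ k₁ B₁ (B₂ i′)) ×
  (∀ (j j′ : Fin b₁) → φ k₂ B₂ (B₁ j) ≡ φ k₂ B₂ (B₁ j′))

complement : ∀ {v b} → (Fin b → Subset v) → (Fin b → Subset v)
complement B s = ∁ (B s)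

module Submission where

-- For a family of blocks B and a set M, the entries of φ(B,M)
-- are the values of the histogram  n ↦ #{ s | |M ∩ B_s| = n }  ("meets").
-- Everything rests on one counting fact about histograms: if two functions
-- f, g satisfy f a + g a = k everywhere, then g takes the value n exactly as
-- often as f takes the value k ∸ n (for n ≤ k), and never a value n > k.
-- Consequently, if f and f′ have equal histograms, so do their
-- "reflections" g and g′.
--   * With blocks of D (size k): |M ∩ D_s| + |∁M ∩ D_s| = k, so passing from
--     M to ∁M reverses φ(D,M) — the second claim — and, since D, D₁ are
--     friends, all φ(D, ∁D₁^s) coincide.
--   * With M = D^j (size k): |D^j ∩ D₁^s| + |D^j ∩ ∁D₁^s| = k, so equal
--     φ(D₁, D^j) for all j give equal φ(∁D₁, D^j) for all j.
-- An entry of φ determines the full histogram because counts beyond the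
-- block size vanish.

open import Defs
open import Level using (Level)
open import Data.Nat using (ℕ; suc; _+_; _∸_; _≤_; _<_; _≟_; _≤?_; s≤s; s≤s⁻¹)
open import Data.Nat.Properties using (+-suc; m+n∸n≡m; m+n∸m≡n; m∸[m∸n]≡n; m≤n+m; ≰⇒>; <⇒≱)
open import Data.Fin using (Fin; toℕ; fromℕ<; opposite)
open import Data.Fin.Properties using (toℕ<n; toℕ-fromℕ<; opposite-prop)
open import Data.Fin.Subset using (Subset; _∩_; ∁; ∣_∣; inside; outside)
open import Data.Fin.Subset.Properties using (∩-comm; ∣p∩q∣≤∣q∣)
open import Data.Vec using (Vec; []; _∷_; lookup; tabulate; count; allFin)
open import Data.Vec.Properties using (lookup∘tabulate; tabulate-cong)
open import Data.Product using (_×_; _,_)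
open import Relation.Nullary using (yes; no; ¬_; contradiction)
open import Relation.Unary using (Pred; Decidable)
open import Relation.Binary.PropositionalEquality
  using (_≡_; refl; sym; trans; cong; cong₂; subst; module ≡-Reasoning)

private
  variable
    a p q : Level
    A A′ : Set a
    m m′ : ℕ

count-cong : {P : Pred A p} {Q : Pred A q} (P? : Decidable P) (Q? : Decidable Q) →
  (∀ x → P x → Q x) → (∀ x → Q x → P x) →
  (xs : Vec A m) → count P? xs ≡ count Q? xs
count-cong P? Q? P⇒Q Q⇒P [] = refl
count-cong P? Q? P⇒Q Q⇒P (x ∷ xs) with P? x | Q? x
... | yes _  | yes _  = cong suc (count-cong P? Q? P⇒Q Q⇒P xs)
... | no _   | no _   = count-cong P? Q? P⇒Q Q⇒P xs
... | yes px | no ¬qx = contradiction (P⇒Q x px) ¬qx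
... | no ¬px | yes qx = contradiction (Q⇒P x qx) ¬px

count-none : {P : Pred A p} (P? : Decidable P) → (∀ x → ¬ P x) →
  (xs : Vec A m) → count P? xs ≡ 0
count-none P? ¬P [] = refl
count-none P? ¬P (x ∷ xs) with P? x
... | yes px = contradiction px (¬P x)
... | no _   = count-none P? ¬P xs

histogram : (A → ℕ) → Vec A m → ℕ → ℕ
histogram f xs n = count (λ x → f x ≟ n) xs

histogram-beyond : ∀ {k n} (f : A → ℕ) (xs : Vec A m) →
  (∀ x → f x ≤ k) → k < n → histogram f xs n ≡ 0
histogram-beyond {k = k} {n} f xs f≤k k<n =
  count-none (λ x → f x ≟ n) (λ x fx≡n → <⇒≱ k<n (subst (_≤ k) fx≡n (f≤k x))) xs

histogram-reflect : ∀ {k n} (f g : A → ℕ) (xs : Vec A m) →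
  (∀ x → f x + g x ≡ k) → n ≤ k →
  histogram g xs n ≡ histogram f xs (k ∸ n)
histogram-reflect {k = k} {n} f g xs f+g≡k n≤k =
  count-cong (λ x → g x ≟ n) (λ x → f x ≟ k ∸ n) g≡n⇒f≡k∸n f≡k∸n⇒g≡n xs
  where
  open ≡-Reasoning
  g≡n⇒f≡k∸n : ∀ x → g x ≡ n → f x ≡ k ∸ n
  g≡n⇒f≡k∸n x gx≡n = begin
    f x             ≡⟨ m+n∸n≡m (f x) (g x) ⟨
    f x + g x ∸ g x ≡⟨ cong₂ _∸_ (f+g≡k x) gx≡n ⟩
    k ∸ n           ∎
  f≡k∸n⇒g≡n : ∀ x → f x ≡ k ∸ n → g x ≡ n
  f≡k∸n⇒g≡n x fx≡k∸n = begin
    g x             ≡⟨ m+n∸m≡n (f x) (g x) ⟨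
    f x + g x ∸ f x ≡⟨ cong₂ _∸_ (f+g≡k x) fx≡k∸n ⟩
    k ∸ (k ∸ n)     ≡⟨ m∸[m∸n]≡n n≤k ⟩
    n               ∎

histogram-reflect-invariant : ∀ {k} (f g : A → ℕ) (xs : Vec A m)
  (f′ g′ : A′ → ℕ) (ys : Vec A′ m′) →
  (∀ x → f x + g x ≡ k) → (∀ y → f′ y + g′ y ≡ k) →
  (∀ n → histogram f xs n ≡ histogram f′ ys n) →
  ∀ n → histogram g xs n ≡ histogram g′ ys n
histogram-reflect-invariant {k = k} f g xs f′ g′ ys f+g≡k f′+g′≡k same n
  with n ≤? k
... | yes n≤k = begin
  histogram g xs n        ≡⟨ histogram-reflect f g xs f+g≡k n≤k ⟩
  histogram f xs (k ∸ n)  ≡⟨ same (k ∸ n) ⟩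
  histogram f′ ys (k ∸ n) ≡⟨ histogram-reflect f′ g′ ys f′+g′≡k n≤k ⟨
  histogram g′ ys n       ∎
  where open ≡-Reasoning
... | no n≰k = trans
  (histogram-beyond g xs (λ x → summand≤ (f+g≡k x)) (≰⇒> n≰k))
  (sym (histogram-beyond g′ ys (λ y → summand≤ (f′+g′≡k y)) (≰⇒> n≰k)))
  where
  summand≤ : ∀ {x y} → x + y ≡ k → y ≤ k
  summand≤ {x} {y} x+y≡k = subst (y ≤_) x+y≡k (m≤n+m y x)

∣p∩q∣+∣∁p∩q∣≡∣q∣ : ∀ {n} (p q : Subset n) → ∣ p ∩ q ∣ + ∣ ∁ p ∩ q ∣ ≡ ∣ q ∣
∣p∩q∣+∣∁p∩q∣≡∣q∣ []            []            = refl
∣p∩q∣+∣∁p∩q∣≡∣q∣ (inside  ∷ p) (inside  ∷ q) = cong suc (∣p∩q∣+∣∁p∩q∣≡∣q∣ p q)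
∣p∩q∣+∣∁p∩q∣≡∣q∣ (outside ∷ p) (inside  ∷ q) =
  trans (+-suc _ _) (cong suc (∣p∩q∣+∣∁p∩q∣≡∣q∣ p q))
∣p∩q∣+∣∁p∩q∣≡∣q∣ (inside  ∷ p) (outside ∷ q) = ∣p∩q∣+∣∁p∩q∣≡∣q∣ p q
∣p∩q∣+∣∁p∩q∣≡∣q∣ (outside ∷ p) (outside ∷ q) = ∣p∩q∣+∣∁p∩q∣≡∣q∣ p q

∣p∩q∣+∣p∩∁q∣≡∣p∣ : ∀ {n} (p q : Subset n) → ∣ p ∩ q ∣ + ∣ p ∩ ∁ q ∣ ≡ ∣ p ∣
∣p∩q∣+∣p∩∁q∣≡∣p∣ p q rewrite ∩-comm p q | ∩-comm p (∁ q) = ∣p∩q∣+∣∁p∩q∣≡∣q∣ q p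

meets : ∀ {v b} → (Fin b → Subset v) → Subset v → ℕ → ℕ
meets {b = b} B M = histogram (λ s → ∣ M ∩ B s ∣) (allFin b)

lookup-φ : ∀ {v b} k (B : Fin b → Subset v) M (j : Fin (suc k)) →
  lookup (φ k B M) j ≡ meets B M (toℕ j)
lookup-φ k B M = lookup∘tabulate (λ j → meets B M (toℕ j))

φ-cong : ∀ {v b b′} k (B : Fin b → Subset v) (B′ : Fin b′ → Subset v) M M′ →
  (∀ n → meets B M n ≡ meets B′ M′ n) → φ k B M ≡ φ k B′ M′
φ-cong k B B′ M M′ same = tabulate-cong (λ j → same (toℕ j))

-- Conversely, when all blocks have size k, φ k B M determines meets B M
-- completely: entries beyond k vanish since |M ∩ B_s| ≤ k.
meets-invariant : ∀ {v b k} (B : Fin b → Subset v) M M′ →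
  (∀ s → ∣ B s ∣ ≡ k) → φ k B M ≡ φ k B M′ →
  ∀ n → meets B M n ≡ meets B M′ n
meets-invariant {k = k} B M M′ size sameφ n with n ≤? k
... | yes n≤k = begin
  meets B M n               ≡⟨ cong (meets B M) (toℕ-fromℕ< n<1+k) ⟨
  meets B M (toℕ j)         ≡⟨ lookup-φ k B M j ⟨
  lookup (φ k B M) j        ≡⟨ cong (λ w → lookup w j) sameφ ⟩
  lookup (φ k B M′) j       ≡⟨ lookup-φ k B M′ j ⟩
  meets B M′ (toℕ j)        ≡⟨ cong (meets B M′) (toℕ-fromℕ< n<1+k) ⟩
  meets B M′ n              ∎
  where
  open ≡-Reasoning
  n<1+k : n < suc k
  n<1+k = s≤s n≤k
  j : Fin (suc k)
  j = fromℕ< n<1+k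
... | no n≰k = trans (vanish M) (sym (vanish M′))
  where
  vanish : ∀ N → meets B N n ≡ 0
  vanish N = histogram-beyond (λ s → ∣ N ∩ B s ∣) (allFin _)
    (λ s → subst (∣ N ∩ B s ∣ ≤_) (size s) (∣p∩q∣≤∣q∣ N (B s))) (≰⇒> n≰k)

set-split : ∀ {v b k} (B : Fin b → Subset v) M → (∀ s → ∣ B s ∣ ≡ k) →
  ∀ s → ∣ M ∩ B s ∣ + ∣ ∁ M ∩ B s ∣ ≡ k
set-split B M size s = trans (∣p∩q∣+∣∁p∩q∣≡∣q∣ M (B s)) (size s)

block-split : ∀ {v b k} (B : Fin b → Subset v) M → ∣ M ∣ ≡ k →
  ∀ s → ∣ M ∩ B s ∣ + ∣ M ∩ complement B s ∣ ≡ k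
block-split B M size s = trans (∣p∩q∣+∣p∩∁q∣≡∣p∣ M (B s)) size

-- For blocks of size k, passing from M to ∁M reverses φ:
-- ∁M meets i points of B_s exactly when M meets k ∸ i of them.
φ-complement : ∀ {v b k} (B : Fin b → Subset v) M → (∀ s → ∣ B s ∣ ≡ k) →
  ∀ (i : Fin (suc k)) → lookup (φ k B (∁ M)) i ≡ lookup (φ k B M) (opposite i)
φ-complement {b = b} {k} B M size i = begin
  lookup (φ k B (∁ M)) i        ≡⟨ lookup-φ k B (∁ M) i ⟩
  meets B (∁ M) (toℕ i)         ≡⟨ histogram-reflect _ _ (allFin b)
                                     (set-split B M size) (s≤s⁻¹ (toℕ<n i)) ⟩
  meets B M (k ∸ toℕ i)         ≡⟨ cong (meets B M) (opposite-prop i) ⟨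
  meets B M (toℕ (opposite i))  ≡⟨ lookup-φ k B M (opposite i) ⟨
  lookup (φ k B M) (opposite i) ∎
  where open ≡-Reasoning

φ-complement-set-cong : ∀ {v b k} (B : Fin b → Subset v) M M′ →
  (∀ s → ∣ B s ∣ ≡ k) → φ k B M ≡ φ k B M′ → φ k B (∁ M) ≡ φ k B (∁ M′)
φ-complement-set-cong {b = b} {k} B M M′ size sameφ =
  φ-cong k B B (∁ M) (∁ M′)
    (histogram-reflect-invariant _ _ (allFin b) _ _ (allFin b)
      (set-split B M size) (set-split B M′ size)
      (meets-invariant B M M′ size sameφ))

φ-complement-blocks-cong : ∀ {v b k k₁} l (B : Fin b → Subset v) M M′ →
  (∀ s → ∣ B s ∣ ≡ k₁) → ∣ M ∣ ≡ k → ∣ M′ ∣ ≡ k →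
  φ k₁ B M ≡ φ k₁ B M′ → φ l (complement B) M ≡ φ l (complement B) M′
φ-complement-blocks-cong {b = b} l B M M′ size ∣M∣≡k ∣M′∣≡k sameφ =
  φ-cong l (complement B) (complement B) M M′
    (histogram-reflect-invariant _ _ (allFin b) _ _ (allFin b)
      (block-split B M ∣M∣≡k) (block-split B M′ ∣M′∣≡k)
      (meets-invariant B M M′ size sameφ))

proposition2 : ∀ {v b r k lam b₁ r₁ k₁ lam₁ : ℕ}
    (D : Fin b → Subset v) (D₁ : Fin b₁ → Subset v) →
    IsDesign v b r k lam D → IsDesign v b₁ r₁ k₁ lam₁ D₁ →
    Friends k D k₁ D₁ →
    Friends k D (v ∸ k₁) (complement D₁) ×
    (∀ (s : Fin b₁) (i : Fin _) →
      lookup (φ k D (complement D₁ s)) i ≡ lookup (φ k D (D₁ s)) (opposite i))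
proposition2 {v = v} {k₁ = k₁} D D₁ isD isD₁ (D₁-blocks-agree , D-blocks-agree) =
  ( (λ s s′ → φ-complement-set-cong D (D₁ s) (D₁ s′) (blockSize isD)
                (D₁-blocks-agree s s′))
  , (λ j j′ → φ-complement-blocks-cong (v ∸ k₁) D₁ (D j) (D j′) (blockSize isD₁)
                (blockSize isD j) (blockSize isD j′) (D-blocks-agree j j′)) )
  , λ s → φ-complement D (D₁ s) (blockSize isD)
  where open IsDesign
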